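{- Let $k$ be a positive rational number with $k\neq 1$, and set \[ a=\big((k^4 + 1)^2 - 4k^2(k^2 + 1)^2\big)^2,\quad b=8k(k^2 + 1)(k^4 + 1)\big((k^4 + 1)^2 - 4k^2(k^2 - 1)^2\big),\quad c=\big((k^4 + 1)^2 + 4k^2(k^2 - 1)^2\big)^2. \] Then $a,b,c$ are the side lengths of a triangle with rational area, and after appropriate scaling by a positive rational factor this triangle becomes a primitive Heron triangle whose two sides corresponding to $a$ and $c$ are perfect squares of integers. Thus $(a,b,c)$ gives a parametric family of primitive Heron triangles with two perfect square sides.
   Context: A Heron triangle is a (non-degenerate) triangle whose three side lengths and whose area are all positive integers; it is primitive if the greatest common divisor of its three side lengths is $1$. -}

module Defs where

open import Data.Nat as ℕ using (ℕ; _∸_)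
open import Data.Nat.GCD using (gcd)
open import Data.Integer using (+_)
open import Data.Rational using (ℚ; _+_; _*_; _-_; _<_; 0ℚ; 1ℚ; _/_)
open import Data.Product using (Σ; _×_; ∃)
open import Relation.Binary.PropositionalEquality using (_≡_)

ℕ→ℚ : ℕ → ℚ
ℕ→ℚ n = + n / 1

16ℚ : ℚ
16ℚ = ℕ→ℚ 16

aₖ : ℚ → ℚ
aₖ k = let k2 = k * k ; k4 = k2 * k2
           t  = (k4 + 1ℚ) * (k4 + 1ℚ) - ℕ→ℚ 4 * k2 * ((k2 + 1ℚ) * (k2 + 1ℚ))
       in t * t

bₖ : ℚ → ℚ
bₖ k = let k2 = k * k ; k4 = k2 * k2
       in ℕ→ℚ 8 * k * (k2 + 1ℚ) * (k4 + 1ℚ)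
            * ((k4 + 1ℚ) * (k4 + 1ℚ) - ℕ→ℚ 4 * k2 * ((k2 - 1ℚ) * (k2 - 1ℚ)))

cₖ : ℚ → ℚ
cₖ k = let k2 = k * k ; k4 = k2 * k2
           t  = (k4 + 1ℚ) * (k4 + 1ℚ) + ℕ→ℚ 4 * k2 * ((k2 - 1ℚ) * (k2 - 1ℚ))
       in t * t

RationalTriangleWithRationalArea : ℚ → ℚ → ℚ → Set
RationalTriangleWithRationalArea a b c =
  (0ℚ < a) × (0ℚ < b) × (0ℚ < c) ×
  (c < a + b) × (b < a + c) × (a < b + c) ×
  Σ ℚ (λ A → (0ℚ < A) ×
     (16ℚ * A * A ≡ (a + b + c) * (b + c - a) * (a + c - b) * (a + b - c)))

-- Heron triangle: positive integer sides, non-degenerate, positive integer area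
-- (truncated subtraction is exact under the strict triangle inequalities)
HeronTriangle : ℕ → ℕ → ℕ → Set
HeronTriangle x y z =
  (0 ℕ.< x) × (0 ℕ.< y) × (0 ℕ.< z) ×
  (z ℕ.< x ℕ.+ y) × (y ℕ.< x ℕ.+ z) × (x ℕ.< y ℕ.+ z) ×
  Σ ℕ (λ S → (0 ℕ.< S) ×
     (16 ℕ.* S ℕ.* S ≡ (x ℕ.+ y ℕ.+ z) ℕ.* (y ℕ.+ z ∸ x) ℕ.* (x ℕ.+ z ∸ y) ℕ.* (x ℕ.+ y ∸ z)))

PrimitiveHeronTriangle : ℕ → ℕ → ℕ → Set
PrimitiveHeronTriangle x y z = HeronTriangle x y z × (gcd (gcd x y) z ≡ 1)

IsSquare : ℕ → Set
IsSquare n = ∃ λ m → n ≡ m ℕ.* m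

{-# OPTIONS --safe #-}
module Submission where

-- Write k = p/q in lowest terms. The sides are dehomogenisations of integral binary forms:
-- aₖ = T(k,1)², bₖ = B(k,1) and cₖ = S(k,1)², where T, S have degree 8 and B degree 16, and
-- Heron's formula holds with area A(k,1) for a form A of degree 32. Hence q¹⁶ scales the
-- triangle to (T(p,q)², B(p,q), S(p,q)²) with area A(p,q). The triangle inequalities follow
-- from factorisations such as a + b - c = 8k(k⁴ + 1)((k + 1) G₃(k,1))², where T = G₃ G₄.
-- A prime dividing T(p,q) divides neither p nor q, so T(p,q) ≠ 0 unless p = q = 1, where
-- T = -12. With U = p⁴ + q⁴ and V = p² + q², the identities S - T = 8p²q²U, U² - T = 4p²q²V²
-- and V² - U = 2p²q² then show that a common prime of T(p,q) and S(p,q) is 2. If p or q is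
-- even, T(p,q) is odd and nothing more is needed; if both are odd, T, S, B, A are 4, 4, 16 and
-- 256 times integers with T/4 odd, and the scaling by q¹⁶/16 gives the primitive triangle.

open import Defs
open import Data.Nat as ℕ using (ℕ; zero; suc)
import Data.Nat.Properties as ℕ
import Data.Nat.Divisibility as ℕ∣
open import Data.Nat.DivMod using (_divMod_; result)
open import Data.Nat.GCD using (gcd; gcd[m,n]∣m)
open import Data.Nat.Coprimality as Coprimality using (Coprime; coprime⇒gcd≡1)
open import Data.Nat.Primality using (Prime; euclidsLemma; prime⇒irreducible; ¬prime[1]; prime[2])
open import Data.Nat.Primality.Factorisation using (factorise)
open import Data.Fin using (zero; suc)
open import Data.List using ([]; _∷_)
open import Data.List.Relation.Unary.All using (_∷_)
open import Data.Vec using (Vec; []; _∷_; lookup; map)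
open import Data.Vec.Properties using (lookup-map)
open import Data.Integer as ℤ using (ℤ; +_; -[1+_])
import Data.Integer.Properties as ℤ
open import Data.Integer.Divisibility.Signed as ℤ∣ using (_∣_; divides)
open import Data.Integer.Tactic.RingSolver using (solve-∀)
open import Data.Rational as ℚ using (ℚ; mkℚ; 0ℚ; 1ℚ)
import Data.Rational.Properties as ℚ
import Data.Rational.Unnormalised as ℚᵘ
import Data.Rational.Unnormalised.Properties as ℚᵘ
open import Data.Product using (Σ; _×_; _,_; proj₁; proj₂)
open import Data.Sum as Sum using (_⊎_; inj₁; inj₂)
open import Data.Empty using (⊥; ⊥-elim)
open import Relation.Nullary using (¬_)
open import Relation.Binary.Definitions using (tri<; tri≈; tri>)
open import Relation.Binary.PropositionalEquality
  using (_≡_; _≢_; refl; sym; trans; cong; cong₂; subst; subst₂; module ≡-Reasoning)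
open import Algebra.Definitions.RawSemiring ℚ.+-*-rawSemiring using (_^_)
open import Algebra.Definitions.RawSemiring ℤ.+-*-rawSemiring using () renaming (_^_ to _^ℤ_)
import Data.Integer.Solver
import Data.Rational.Solver

module ℤS = Data.Integer.Solver.+-*-Solver
module ℚS = Data.Rational.Solver.+-*-Solver
open ℤS using (Polynomial; op; con; var; _:^_; :-_; _:+_; _:*_; _:-_)

ι : ℤ → ℚ
ι z = mkℚ z 0 (Coprimality.sym (Coprimality.1-coprimeTo _))

ℕ→ℚ≡ι : ∀ n → ℕ→ℚ n ≡ ι (+ n)
ℕ→ℚ≡ι n = ℚ.fromℚᵘ-toℚᵘ (ι (+ n))

ι-injective : ∀ {a b} → ι a ≡ ι b → a ≡ b
ι-injective refl = refl

ι-+ : ∀ a b → ι (a ℤ.+ b) ≡ ι a ℚ.+ ι b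
ι-+ a b = ℚ.toℚᵘ-injective
  (ℚᵘ.≃-sym (ℚᵘ.≃-trans (ℚ.toℚᵘ-homo-+ (ι a) (ι b)) (ℚᵘ.*≡* (identity a b))))
  where
  identity : ∀ a b → (a ℤ.* + 1 ℤ.+ b ℤ.* + 1) ℤ.* + 1 ≡ (a ℤ.+ b) ℤ.* + 1
  identity = solve-∀

ι-* : ∀ a b → ι (a ℤ.* b) ≡ ι a ℚ.* ι b
ι-* a b = ℚ.toℚᵘ-injective (ℚᵘ.≃-sym (ℚᵘ.≃-trans (ℚ.toℚᵘ-homo-* (ι a) (ι b)) (ℚᵘ.*≡* refl)))

ι-neg : ∀ a → ι (ℤ.- a) ≡ ℚ.- ι a
ι-neg (+ zero)  = refl
ι-neg (+ suc n) = refl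
ι-neg -[1+ n ]  = refl

ι-- : ∀ a b → ι (a ℤ.- b) ≡ ι a ℚ.- ι b
ι-- a b = trans (ι-+ a (ℤ.- b)) (cong (ι a ℚ.+_) (ι-neg b))

ι-^ : ∀ a n → ι (a ^ℤ n) ≡ ι a ^ n
ι-^ a zero    = refl
ι-^ a (suc n) = trans (ι-* a (a ^ℤ n)) (cong (ι a ℚ.*_) (ι-^ a n))

ι-pos : ∀ {n} → 0 ℕ.< n → 0ℚ ℚ.< ι (+ n)
ι-pos (ℕ.s≤s _) = ℚ.*<* (ℤ.+<+ (ℕ.s≤s ℕ.z≤n))

0<ι⇒ι≡ℕ→ℚ∣∣ : ∀ {z} → 0ℚ ℚ.< ι z → ι z ≡ ℕ→ℚ ℤ.∣ z ∣
0<ι⇒ι≡ℕ→ℚ∣∣ { -[1+ n ]} (ℚ.*<* ())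
0<ι⇒ι≡ℕ→ℚ∣∣ {+ n}       _ = sym (ℕ→ℚ≡ι n)

∣ι∣≡ℕ→ℚ∣∣ : ∀ z → ℚ.∣ ι z ∣ ≡ ℕ→ℚ ℤ.∣ z ∣
∣ι∣≡ℕ→ℚ∣∣ (+ n)    = sym (ℕ→ℚ≡ι n)
∣ι∣≡ℕ→ℚ∣∣ -[1+ n ] = sym (ℕ→ℚ≡ι (suc n))

ι*ι≡ℕ→ℚ∣∣*∣∣ : ∀ z → ι z ℚ.* ι z ≡ ℕ→ℚ (ℤ.∣ z ∣ ℕ.* ℤ.∣ z ∣)
ι*ι≡ℕ→ℚ∣∣*∣∣ z = trans (sym (ι-* z z)) (trans (cong ι (square≡ z)) (sym (ℕ→ℚ≡ι _)))
  where
  square≡ : ∀ z → z ℤ.* z ≡ + (ℤ.∣ z ∣ ℕ.* ℤ.∣ z ∣)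
  square≡ (+ n)    = sym (ℤ.pos-* n n)
  square≡ -[1+ n ] = refl

-- Integral binary forms

_[_] : ∀ {m n} → Polynomial m → Vec (Polynomial n) m → Polynomial n
op o e f [ σ ] = op o (e [ σ ]) (f [ σ ])
con c    [ σ ] = con c
var i    [ σ ] = lookup σ i
(e :^ n) [ σ ] = e [ σ ] :^ n
(:- e)   [ σ ] = :- (e [ σ ])

ℤ→ℚ : ∀ {n} → Polynomial n → ℚS.Polynomial n
ℤ→ℚ (op ℤS.[+] e f) = ℤ→ℚ e ℚS.:+ ℤ→ℚ f
ℤ→ℚ (op ℤS.[*] e f) = ℤ→ℚ e ℚS.:* ℤ→ℚ f
ℤ→ℚ (con c)         = ℚS.con (ι c)
ℤ→ℚ (var i)         = ℚS.var i
ℤ→ℚ (e :^ n)        = ℤ→ℚ e ℚS.:^ n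
ℤ→ℚ (:- e)          = ℚS.:- ℤ→ℚ e

ι-⟦⟧ : ∀ {n} (e : Polynomial n) (ρ : Vec ℤ n) → ι (ℤS.⟦ e ⟧ ρ) ≡ ℚS.⟦ ℤ→ℚ e ⟧ (map ι ρ)
ι-⟦⟧ (op ℤS.[+] e f) ρ =
  trans (ι-+ (ℤS.⟦ e ⟧ ρ) (ℤS.⟦ f ⟧ ρ)) (cong₂ ℚ._+_ (ι-⟦⟧ e ρ) (ι-⟦⟧ f ρ))
ι-⟦⟧ (op ℤS.[*] e f) ρ =
  trans (ι-* (ℤS.⟦ e ⟧ ρ) (ℤS.⟦ f ⟧ ρ)) (cong₂ ℚ._*_ (ι-⟦⟧ e ρ) (ι-⟦⟧ f ρ))
ι-⟦⟧ (con c)  ρ = refl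
ι-⟦⟧ (var i)  ρ = sym (lookup-map i ι ρ)
ι-⟦⟧ (e :^ n) ρ = trans (ι-^ (ℤS.⟦ e ⟧ ρ) n) (cong (_^ n) (ι-⟦⟧ e ρ))
ι-⟦⟧ (:- e)   ρ = trans (ι-neg (ℤS.⟦ e ⟧ ρ)) (cong ℚ.-_ (ι-⟦⟧ e ρ))

X Y : Polynomial 2
X = var zero
Y = var (suc zero)

_⟦_,_⟧ : Polynomial 2 → ℤ → ℤ → ℤ
e ⟦ P , Q ⟧ = ℤS.⟦ e ⟧ (P ∷ Q ∷ [])

_⟨_⟩ : Polynomial 2 → ℚ → ℚ
e ⟨ k ⟩ = ℚS.⟦ ℤ→ℚ e ⟧ (k ∷ 1ℚ ∷ [])

-- For a closed e, ℚS.⟦ dehomogenise e ⟧ (k ∷ []) computes to e ⟨ k ⟩, so equations between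
-- such values are proved by ℚS.prove on dehomogenised syntax with the normal-form proof refl.
dehomogenise : Polynomial 2 → ℚS.Polynomial 1
dehomogenise e = ℤ→ℚ (e [ var zero ∷ con (+ 1) ∷ [] ])

IsHomogeneous : ℕ → Polynomial 2 → Set
IsHomogeneous d e = ∀ k q → q ^ d ℚ.* e ⟨ k ⟩ ≡ ℚS.⟦ ℤ→ℚ e ⟧ (k ℚ.* q ∷ q ∷ [])

homogeneous-at-fraction : ∀ d e → IsHomogeneous d e → ∀ {k p q} → k ℚ.* ι q ≡ ι p →
                          ι q ^ d ℚ.* e ⟨ k ⟩ ≡ ι (e ⟦ p , q ⟧)
homogeneous-at-fraction d e homogeneous {k} {p} {q} kq≡p = begin
  ι q ^ d ℚ.* e ⟨ k ⟩                  ≡⟨ homogeneous k (ι q) ⟩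
  ℚS.⟦ ℤ→ℚ e ⟧ (k ℚ.* ι q ∷ ι q ∷ [])  ≡⟨ cong (λ p′ → ℚS.⟦ ℤ→ℚ e ⟧ (p′ ∷ ι q ∷ [])) kq≡p ⟩
  ℚS.⟦ ℤ→ℚ e ⟧ (ι p ∷ ι q ∷ [])        ≡⟨ ι-⟦⟧ e (p ∷ q ∷ []) ⟨
  ι (e ⟦ p , q ⟧)                      ∎
  where open ≡-Reasoning

-- In 𝕋, 𝕊 and 𝔹 every Y sits inside a closed subterm, so at Y = 1 they compute to the
-- expressions of Defs: aₖ k, bₖ k and cₖ k are (𝕋 :* 𝕋) ⟨ k ⟩, 𝔹 ⟨ k ⟩ and (𝕊 :* 𝕊) ⟨ k ⟩ by refl.
X² Y² X⁴ Y⁴ 𝕌 𝕍 𝕎 𝕄 𝔾₃ 𝔾₄ 𝕋 𝕊 𝔹 𝔸 : Polynomial 2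
X² = X :* X
Y² = Y :* Y
X⁴ = X² :* X²
Y⁴ = Y² :* Y²
𝕌 = X⁴ :+ Y⁴
𝕍 = X² :+ Y²
𝕎 = X² :- Y²
𝕄 = 𝕎 :* 𝕎 :* (𝕎 :* 𝕎) :+ con (+ 4) :* Y⁴ :* X⁴
𝔾₃ = X⁴ :- con (+ 2) :* X² :* X :* Y :- con (+ 2) :* X :* Y² :* Y :+ Y⁴
𝔾₄ = X⁴ :+ con (+ 2) :* X² :* X :* Y :+ con (+ 2) :* X :* Y² :* Y :+ Y⁴
𝕋 = 𝕌 :* 𝕌 :- con (+ 4) :* Y² :* X² :* (𝕍 :* 𝕍)
𝕊 = 𝕌 :* 𝕌 :+ con (+ 4) :* Y² :* X² :* (𝕎 :* 𝕎)
𝔹 = con (+ 8) :* Y :* X :* 𝕍 :* 𝕌 :* (𝕌 :* 𝕌 :- con (+ 4) :* Y² :* X² :* (𝕎 :* 𝕎))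
𝔸 = con (+ 4) :* Y :* X :* 𝕌 :* 𝕄 :* 𝕎 :* (𝕋 :* 𝕋)

𝕋-homogeneous : IsHomogeneous 8 𝕋
𝕋-homogeneous k q = ℚS.prove (k ∷ q ∷ [])
  (ℤ→ℚ (Y :^ 8 :* 𝕋 [ X ∷ con (+ 1) ∷ [] ])) (ℤ→ℚ (𝕋 [ X :* Y ∷ Y ∷ [] ])) refl

𝕊-homogeneous : IsHomogeneous 8 𝕊
𝕊-homogeneous k q = ℚS.prove (k ∷ q ∷ [])
  (ℤ→ℚ (Y :^ 8 :* 𝕊 [ X ∷ con (+ 1) ∷ [] ])) (ℤ→ℚ (𝕊 [ X :* Y ∷ Y ∷ [] ])) refl

𝔹-homogeneous : IsHomogeneous 16 𝔹
𝔹-homogeneous k q = ℚS.prove (k ∷ q ∷ [])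
  (ℤ→ℚ (Y :^ 16 :* 𝔹 [ X ∷ con (+ 1) ∷ [] ])) (ℤ→ℚ (𝔹 [ X :* Y ∷ Y ∷ [] ])) refl

𝔸-homogeneous : IsHomogeneous 32 𝔸
𝔸-homogeneous k q = ℚS.prove (k ∷ q ∷ [])
  (ℤ→ℚ (Y :^ 32 :* 𝔸 [ X ∷ con (+ 1) ∷ [] ])) (ℤ→ℚ (𝔸 [ X :* Y ∷ Y ∷ [] ])) refl

-- Common prime divisors of T and S

coprime-if-no-common-prime : ∀ {m n} → (∀ {r} → Prime r → r ℕ∣.∣ m → r ℕ∣.∣ n → ⊥) →
                             Coprime m n
coprime-if-no-common-prime no-common-prime {zero} (0∣m , 0∣n) =
  ⊥-elim (no-common-prime prime[2] (subst (2 ℕ∣.∣_) (sym (ℕ∣.0∣⇒≡0 0∣m)) (2 ℕ∣.∣0))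
                                   (subst (2 ℕ∣.∣_) (sym (ℕ∣.0∣⇒≡0 0∣n)) (2 ℕ∣.∣0)))
coprime-if-no-common-prime no-common-prime {suc i} (i∣m , i∣n) with factorise (suc i)
... | record { factors = [] ; isFactorisation = i≡1 } = i≡1
... | record { factors = r ∷ rs ; isFactorisation = i≡r*rs ; factorsPrime = r-prime ∷ _ } =
  ⊥-elim (no-common-prime r-prime (ℕ∣.∣-trans r∣i i∣m) (ℕ∣.∣-trans r∣i i∣n))
  where
  r∣i : r ℕ∣.∣ suc i
  r∣i = subst (r ℕ∣.∣_) (sym i≡r*rs) (ℕ∣.m∣m*n _)

coprime⇒gcd[m²,y,n²]≡1 : ∀ {m n} y → Coprime m n → gcd (gcd (m ℕ.* m) y) (n ℕ.* n) ≡ 1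
coprime⇒gcd[m²,y,n²]≡1 {m} {n} y m⊥n = coprime⇒gcd≡1 (coprime-if-no-common-prime λ r-prime r∣gcd r∣n² →
  ¬prime[1] (subst Prime (m⊥n ( prime∣square r-prime (ℕ∣.∣-trans r∣gcd (gcd[m,n]∣m (m ℕ.* m) y))
                              , prime∣square r-prime r∣n²)) r-prime))
  where
  prime∣square : ∀ {r a} → Prime r → r ℕ∣.∣ a ℕ.* a → r ℕ∣.∣ a
  prime∣square {a = a} r-prime r∣aa = Sum.reduce (euclidsLemma a a r-prime r∣aa)

prime∣* : ∀ {r} a b → Prime r → + r ∣ a ℤ.* b → + r ∣ a ⊎ + r ∣ b
prime∣* {r} a b r-prime r∣ab = Sum.map ℤ∣.∣ᵤ⇒∣ ℤ∣.∣ᵤ⇒∣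
  (euclidsLemma ℤ.∣ a ∣ ℤ.∣ b ∣ r-prime (subst (r ℕ∣.∣_) (ℤ.abs-* a b) (ℤ∣.∣⇒∣ᵤ r∣ab)))

prime∣square : ∀ {r} a → Prime r → + r ∣ a ℤ.* a → + r ∣ a
prime∣square a r-prime r∣aa = Sum.reduce (prime∣* a a r-prime r∣aa)

prime∣2ⁿ : ∀ {r} n → Prime r → + r ∣ + (2 ℕ.^ n) → r ≡ 2
prime∣2ⁿ zero    r-prime r∣1 = ⊥-elim (¬prime[1] (subst Prime (ℕ∣.∣1⇒≡1 (ℤ∣.∣⇒∣ᵤ r∣1)) r-prime))
prime∣2ⁿ {r} (suc n) r-prime r∣2ⁿ⁺¹ = Sum.[ prime∣2 , prime∣2ⁿ n r-prime ]
  (prime∣* (+ 2) (+ (2 ℕ.^ n)) r-prime (subst (_ ∣_) (ℤ.pos-* 2 (2 ℕ.^ n)) r∣2ⁿ⁺¹))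
  where
  prime∣2 : + r ∣ + 2 → r ≡ 2
  prime∣2 r∣2 = Sum.fromInj₂ (λ r≡1 → ⊥-elim (¬prime[1] (subst Prime r≡1 r-prime)))
                             (prime⇒irreducible prime[2] (ℤ∣.∣⇒∣ᵤ r∣2))

coprime⇒no-common-prime : ∀ {p q} → Coprime p q → ∀ {r} → Prime r → + r ∣ + p → + r ∣ + q → ⊥
coprime⇒no-common-prime p⊥q r-prime r∣p r∣q =
  ¬prime[1] (subst Prime (p⊥q (ℤ∣.∣⇒∣ᵤ r∣p , ℤ∣.∣⇒∣ᵤ r∣q)) r-prime)

coprime-if-common-primes-are-2 : ∀ {a b} → (∀ {r} → Prime r → + r ∣ a → + r ∣ b → r ≡ 2) →
                                 ¬ (+ 2 ∣ a) → Coprime ℤ.∣ a ∣ ℤ.∣ b ∣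
coprime-if-common-primes-are-2 {a} common-prime-is-2 a-odd =
  coprime-if-no-common-prime λ r-prime r∣a r∣b →
    a-odd (subst (λ r → + r ∣ a) (common-prime-is-2 r-prime (ℤ∣.∣ᵤ⇒∣ r∣a) (ℤ∣.∣ᵤ⇒∣ r∣b)) (ℤ∣.∣ᵤ⇒∣ r∣a))

module CommonPrimes (P Q : ℤ) (coprime : ∀ {r} → Prime r → + r ∣ P → + r ∣ Q → ⊥) where

  open import Data.Integer.Base using (_+_; _*_)

  private
    T U V : ℤ
    T = 𝕋 ⟦ P , Q ⟧
    U = 𝕌 ⟦ P , Q ⟧
    V = 𝕍 ⟦ P , Q ⟧

    S≡T+ : 𝕊 ⟦ P , Q ⟧ ≡ T + + 8 * (Q * Q) * (P * P) * U
    S≡T+ = ℤS.prove (P ∷ Q ∷ []) 𝕊 (𝕋 :+ con (+ 8) :* Y² :* X² :* 𝕌) refl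

    U²≡T+ : U * U ≡ T + + 4 * (Q * Q) * (P * P) * (V * V)
    U²≡T+ = ℤS.prove (P ∷ Q ∷ []) (𝕌 :* 𝕌) (𝕋 :+ con (+ 4) :* Y² :* X² :* (𝕍 :* 𝕍)) refl

    V²≡U+ : V * V ≡ U + + 2 * (Q * Q) * (P * P)
    V²≡U+ = ℤS.prove (P ∷ Q ∷ []) (𝕍 :* 𝕍) (𝕌 :+ con (+ 2) :* Y² :* X²) refl

  prime∣T⇒∤P : ∀ {r} → Prime r → + r ∣ T → ¬ (+ r ∣ P)
  prime∣T⇒∤P {r} r-prime r∣T r∣P =
    coprime r-prime r∣P (prime∣square Q r-prime (prime∣square (Q * Q) r-prime r∣Q⁴))
    where
    r∣U : + r ∣ U
    r∣U = prime∣square U r-prime (subst (+ r ∣_) (sym U²≡T+) (ℤ∣.∣m∣n⇒∣m+n r∣T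
            (ℤ∣.∣m⇒∣m*n (V * V) (ℤ∣.∣n⇒∣m*n (+ 4 * (Q * Q)) (ℤ∣.∣m⇒∣m*n P r∣P)))))
    r∣Q⁴ : + r ∣ Q * Q * (Q * Q)
    r∣Q⁴ = ℤ∣.∣m+n∣m⇒∣n r∣U (ℤ∣.∣m⇒∣m*n (P * P) (ℤ∣.∣m⇒∣m*n P r∣P))

  prime∣T⇒∤Q : ∀ {r} → Prime r → + r ∣ T → ¬ (+ r ∣ Q)
  prime∣T⇒∤Q {r} r-prime r∣T r∣Q =
    coprime r-prime (prime∣square P r-prime (prime∣square (P * P) r-prime r∣P⁴)) r∣Q
    where
    r∣U : + r ∣ U
    r∣U = prime∣square U r-prime (subst (+ r ∣_) (sym U²≡T+) (ℤ∣.∣m∣n⇒∣m+n r∣T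
            (ℤ∣.∣m⇒∣m*n (V * V) (ℤ∣.∣m⇒∣m*n (P * P) (ℤ∣.∣n⇒∣m*n (+ 4) (ℤ∣.∣m⇒∣m*n Q r∣Q))))))
    r∣P⁴ : + r ∣ P * P * (P * P)
    r∣P⁴ = ℤ∣.∣m+n∣n⇒∣m r∣U (ℤ∣.∣m⇒∣m*n (Q * Q) (ℤ∣.∣m⇒∣m*n Q r∣Q))

  prime∣T⇒∣coefficient : ∀ {r} c → Prime r → + r ∣ T → + r ∣ c * (Q * Q) * (P * P) → + r ∣ c
  prime∣T⇒∣coefficient {r} c r-prime r∣T r∣cQ²P² = Sum.[ from-cQ² , from-P² ]
    (prime∣* (c * (Q * Q)) (P * P) r-prime r∣cQ²P²)
    where
    from-P² : + r ∣ P * P → + r ∣ c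
    from-P² r∣P² = ⊥-elim (prime∣T⇒∤P r-prime r∣T (prime∣square P r-prime r∣P²))
    from-cQ² : + r ∣ c * (Q * Q) → + r ∣ c
    from-cQ² r∣cQ² = Sum.fromInj₁ (λ r∣Q² → ⊥-elim (prime∣T⇒∤Q r-prime r∣T (prime∣square Q r-prime r∣Q²)))
                                  (prime∣* c (Q * Q) r-prime r∣cQ²)

  common-prime-of-𝕋-𝕊≡2 : ∀ {r} → Prime r → + r ∣ T → + r ∣ 𝕊 ⟦ P , Q ⟧ → r ≡ 2
  common-prime-of-𝕋-𝕊≡2 {r} r-prime r∣T r∣S = Sum.[ from-8Q²P² , from-U ]
    (prime∣* (+ 8 * (Q * Q) * (P * P)) U r-prime (ℤ∣.∣m+n∣m⇒∣n (subst (+ r ∣_) S≡T+ r∣S) r∣T))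
    where
    from-8Q²P² : + r ∣ + 8 * (Q * Q) * (P * P) → r ≡ 2
    from-8Q²P² r∣8Q²P² = prime∣2ⁿ 3 r-prime (prime∣T⇒∣coefficient (+ 8) r-prime r∣T r∣8Q²P²)
    from-U : + r ∣ U → r ≡ 2
    from-U r∣U = Sum.[ from-4Q²P² , from-V² ]
      (prime∣* (+ 4 * (Q * Q) * (P * P)) (V * V) r-prime
        (ℤ∣.∣m+n∣m⇒∣n (subst (+ r ∣_) U²≡T+ (ℤ∣.∣m⇒∣m*n U r∣U)) r∣T))
      where
      from-4Q²P² : + r ∣ + 4 * (Q * Q) * (P * P) → r ≡ 2
      from-4Q²P² r∣4Q²P² = prime∣2ⁿ 2 r-prime (prime∣T⇒∣coefficient (+ 4) r-prime r∣T r∣4Q²P²)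
      from-V² : + r ∣ V * V → r ≡ 2
      from-V² r∣V² = prime∣2ⁿ 1 r-prime (prime∣T⇒∣coefficient (+ 2) r-prime r∣T
        (ℤ∣.∣m+n∣m⇒∣n (subst (+ r ∣_) V²≡U+ r∣V²) r∣U))

𝕋≢0 : ∀ {p q} → Coprime p q → 𝕋 ⟦ + p , + q ⟧ ≢ + 0
𝕋≢0 {p} {q} p⊥q T≡0 = 𝕋[1,1]≢0 (subst₂ (λ p q → 𝕋 ⟦ + p , + q ⟧ ≡ + 0) p≡1 q≡1 T≡0)
  where
  open CommonPrimes (+ p) (+ q) (coprime⇒no-common-prime p⊥q)
  𝕋[1,1]≢0 : 𝕋 ⟦ + 1 , + 1 ⟧ ≢ + 0
  𝕋[1,1]≢0 ()
  every-prime∣T : ∀ {r} → + r ∣ 𝕋 ⟦ + p , + q ⟧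
  every-prime∣T {r} = subst (+ r ∣_) (sym T≡0) (ℤ∣.∣ᵤ⇒∣ (r ℕ∣.∣0))
  p≡1 : p ≡ 1
  p≡1 = coprime-if-no-common-prime
    (λ r-prime r∣p _ → prime∣T⇒∤P r-prime every-prime∣T (ℤ∣.∣ᵤ⇒∣ r∣p)) (ℕ∣.∣-refl , ℕ∣.∣-refl)
  q≡1 : q ≡ 1
  q≡1 = coprime-if-no-common-prime
    (λ r-prime r∣q _ → prime∣T⇒∤Q r-prime every-prime∣T (ℤ∣.∣ᵤ⇒∣ r∣q)) (ℕ∣.∣-refl , ℕ∣.∣-refl)

record PrimitiveReduction (P Q : ℤ) : Set where
  field
    d       : ℕ
    x y z s : ℤ
    𝕋≡      : 𝕋 ⟦ P , Q ⟧ ≡ + d ℤ.* x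
    𝔹≡      : 𝔹 ⟦ P , Q ⟧ ≡ + d ℤ.* (+ d ℤ.* y)
    𝕊≡      : 𝕊 ⟦ P , Q ⟧ ≡ + d ℤ.* z
    𝔸≡      : 𝔸 ⟦ P , Q ⟧ ≡ + d ℤ.* (+ d ℤ.* (+ d ℤ.* (+ d ℤ.* s)))
    x⊥z     : Coprime ℤ.∣ x ∣ ℤ.∣ z ∣
    {{d≢0}} : ℕ.NonZero d

reduction-when-one-is-even : ∀ {p q} → Coprime p q → + 2 ∣ + p ⊎ + 2 ∣ + q →
                             PrimitiveReduction (+ p) (+ q)
reduction-when-one-is-even {p} {q} p⊥q one-even = record
  { d = 1 ; x = 𝕋 ⟦ + p , + q ⟧ ; y = 𝔹 ⟦ + p , + q ⟧ ; z = 𝕊 ⟦ + p , + q ⟧ ; s = 𝔸 ⟦ + p , + q ⟧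
  ; 𝕋≡ = sym (ℤ.*-identityˡ _)
  ; 𝔹≡ = sym (trans (ℤ.*-identityˡ _) (ℤ.*-identityˡ _))
  ; 𝕊≡ = sym (ℤ.*-identityˡ _)
  ; 𝔸≡ = sym (trans (ℤ.*-identityˡ _) (trans (ℤ.*-identityˡ _) (trans (ℤ.*-identityˡ _) (ℤ.*-identityˡ _))))
  ; x⊥z = coprime-if-common-primes-are-2 common-prime-of-𝕋-𝕊≡2
            (λ 2∣T → Sum.[ prime∣T⇒∤P prime[2] 2∣T , prime∣T⇒∤Q prime[2] 2∣T ] one-even)
  }
  where open CommonPrimes (+ p) (+ q) (coprime⇒no-common-prime p⊥q)

module OddReduction (P Q a b : ℤ) (P²≡ : P ℤ.* P ≡ + 4 ℤ.* a ℤ.+ + 1)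
                    (Q²≡ : Q ℤ.* Q ≡ + 4 ℤ.* b ℤ.+ + 1)
                    (coprime : ∀ {r} → Prime r → + r ∣ P → + r ∣ Q → ⊥) where

  open import Data.Integer.Base using (_+_; _-_; _*_)
  open CommonPrimes P Q coprime

  h H V′ W′ M′ T′ S′ B′ A′ : ℤ
  h  = + 4 * (a * a) + + 2 * a + + 4 * (b * b) + + 2 * b
  H  = + 2 * h + + 1
  V′ = + 2 * (a + b) + + 1
  W′ = a - b
  M′ = + 64 * (W′ * W′ * (W′ * W′)) + Q * Q * (Q * Q) * (P * P * (P * P))
  T′ = H * H - + 4 * (Q * Q) * (P * P) * (V′ * V′)
  S′ = H * H + + 16 * (Q * Q) * (P * P) * (W′ * W′)
  B′ = + 8 * Q * P * V′ * H * (H * H - + 16 * (Q * Q) * (P * P) * (W′ * W′))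
  A′ = + 8 * Q * P * H * M′ * W′ * (T′ * T′)

  𝕌≡ : 𝕌 ⟦ P , Q ⟧ ≡ + 2 * H
  𝕌≡ = trans (cong₂ (λ p² q² → p² * p² + q² * q²) P²≡ Q²≡) (identity a b)
    where
    identity : ∀ a b → (+ 4 * a + + 1) * (+ 4 * a + + 1) + (+ 4 * b + + 1) * (+ 4 * b + + 1)
                       ≡ + 2 * (+ 2 * (+ 4 * (a * a) + + 2 * a + + 4 * (b * b) + + 2 * b) + + 1)
    identity = solve-∀

  𝕍≡ : 𝕍 ⟦ P , Q ⟧ ≡ + 2 * V′
  𝕍≡ = trans (cong₂ _+_ P²≡ Q²≡) (identity a b)
    where
    identity : ∀ a b → + 4 * a + + 1 + (+ 4 * b + + 1) ≡ + 2 * (+ 2 * (a + b) + + 1)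
    identity = solve-∀

  𝕎≡ : 𝕎 ⟦ P , Q ⟧ ≡ + 4 * W′
  𝕎≡ = trans (cong₂ _-_ P²≡ Q²≡) (identity a b)
    where
    identity : ∀ a b → + 4 * a + + 1 - (+ 4 * b + + 1) ≡ + 4 * (a - b)
    identity = solve-∀

  𝕄≡ : 𝕄 ⟦ P , Q ⟧ ≡ + 4 * M′
  𝕄≡ = trans (cong (λ w → w * w * (w * w) + + 4 * (Q * Q * (Q * Q)) * (P * P * (P * P))) 𝕎≡)
             (identity W′ (Q * Q * (Q * Q)) (P * P * (P * P)))
    where
    identity : ∀ W′ Q⁴ P⁴ → (+ 4 * W′) * (+ 4 * W′) * ((+ 4 * W′) * (+ 4 * W′)) + + 4 * Q⁴ * P⁴
                             ≡ + 4 * (+ 64 * (W′ * W′ * (W′ * W′)) + Q⁴ * P⁴)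
    identity = solve-∀

  𝕋≡ : 𝕋 ⟦ P , Q ⟧ ≡ + 4 * T′
  𝕋≡ = trans (cong₂ (λ u v → u * u - + 4 * (Q * Q) * (P * P) * (v * v)) 𝕌≡ 𝕍≡)
             (identity P Q H V′)
    where
    identity : ∀ P Q H V′ → (+ 2 * H) * (+ 2 * H) - + 4 * (Q * Q) * (P * P) * ((+ 2 * V′) * (+ 2 * V′))
                            ≡ + 4 * (H * H - + 4 * (Q * Q) * (P * P) * (V′ * V′))
    identity = solve-∀

  𝕊≡ : 𝕊 ⟦ P , Q ⟧ ≡ + 4 * S′
  𝕊≡ = trans (cong₂ (λ u w → u * u + + 4 * (Q * Q) * (P * P) * (w * w)) 𝕌≡ 𝕎≡)
             (identity P Q H W′)
    where
    identity : ∀ P Q H W′ → (+ 2 * H) * (+ 2 * H) + + 4 * (Q * Q) * (P * P) * ((+ 4 * W′) * (+ 4 * W′))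
                            ≡ + 4 * (H * H + + 16 * (Q * Q) * (P * P) * (W′ * W′))
    identity = solve-∀

  𝔹≡ : 𝔹 ⟦ P , Q ⟧ ≡ + 4 * (+ 4 * B′)
  𝔹≡ = trans (cong₂ (λ (u , v) w → + 8 * Q * P * v * u * (u * u - + 4 * (Q * Q) * (P * P) * (w * w)))
                    (cong₂ _,_ 𝕌≡ 𝕍≡) 𝕎≡)
             (identity P Q H V′ W′)
    where
    identity : ∀ P Q H V′ W′ →
      + 8 * Q * P * (+ 2 * V′) * (+ 2 * H)
        * ((+ 2 * H) * (+ 2 * H) - + 4 * (Q * Q) * (P * P) * ((+ 4 * W′) * (+ 4 * W′)))
      ≡ + 4 * (+ 4 * (+ 8 * Q * P * V′ * H * (H * H - + 16 * (Q * Q) * (P * P) * (W′ * W′))))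
    identity = solve-∀

  𝔸≡ : 𝔸 ⟦ P , Q ⟧ ≡ + 4 * (+ 4 * (+ 4 * (+ 4 * A′)))
  𝔸≡ = trans (cong₂ (λ (u , m) (w , t) → + 4 * Q * P * u * m * w * (t * t))
                    (cong₂ _,_ 𝕌≡ 𝕄≡) (cong₂ _,_ 𝕎≡ 𝕋≡))
             (identity Q P H M′ W′ T′)
    where
    identity : ∀ Q P H M′ W′ T′ →
      + 4 * Q * P * (+ 2 * H) * (+ 4 * M′) * (+ 4 * W′) * ((+ 4 * T′) * (+ 4 * T′))
      ≡ + 4 * (+ 4 * (+ 4 * (+ 4 * (+ 8 * Q * P * H * M′ * W′ * (T′ * T′)))))
    identity = solve-∀

  T′-odd : ¬ (+ 2 ∣ T′)
  T′-odd 2∣T′ = 2∤1 (ℤ∣.∣m+n∣m⇒∣n 2∣2h+1 (ℤ∣.∣m⇒∣m*n h ℤ∣.∣-refl))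
    where
    2∣4Q²P²V′² : + 2 ∣ + 4 * (Q * Q) * (P * P) * (V′ * V′)
    2∣4Q²P²V′² = ℤ∣.∣m⇒∣m*n (V′ * V′) (ℤ∣.∣m⇒∣m*n (P * P) (ℤ∣.∣m⇒∣m*n (Q * Q) (divides (+ 2) refl)))
    2∣2h+1 : + 2 ∣ + 2 * h + + 1
    2∣2h+1 = prime∣square H prime[2] (ℤ∣.∣m+n∣n⇒∣m 2∣T′ (ℤ∣.∣m⇒∣-m 2∣4Q²P²V′²))
    2∤1 : ¬ (+ 2 ∣ + 1)
    2∤1 2∣1 with ℕ∣.∣1⇒≡1 (ℤ∣.∣⇒∣ᵤ 2∣1)
    ... | ()

  reduction : PrimitiveReduction P Q
  reduction = record
    { d = 4 ; x = T′ ; y = B′ ; z = S′ ; s = A′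
    ; 𝕋≡ = 𝕋≡ ; 𝔹≡ = 𝔹≡ ; 𝕊≡ = 𝕊≡ ; 𝔸≡ = 𝔸≡
    ; x⊥z = coprime-if-common-primes-are-2 common-prime-of-T′-S′≡2 T′-odd
    }
    where
    common-prime-of-T′-S′≡2 : ∀ {r} → Prime r → + r ∣ T′ → + r ∣ S′ → r ≡ 2
    common-prime-of-T′-S′≡2 r-prime r∣T′ r∣S′ = common-prime-of-𝕋-𝕊≡2 r-prime
      (subst (_ ∣_) (sym 𝕋≡) (ℤ∣.∣n⇒∣m*n (+ 4) r∣T′)) (subst (_ ∣_) (sym 𝕊≡) (ℤ∣.∣n⇒∣m*n (+ 4) r∣S′))

even⇒2∣ : ∀ {n} i → n ≡ i ℕ.* 2 → + 2 ∣ + n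
even⇒2∣ i refl = divides (+ i) (ℤ.pos-* i 2)

odd⇒square≡4a+1 : ∀ {n} i → n ≡ 1 ℕ.+ i ℕ.* 2 → + n ℤ.* + n ≡ + 4 ℤ.* (+ i ℤ.* + i ℤ.+ + i) ℤ.+ + 1
odd⇒square≡4a+1 i refl =
  trans (cong (λ n → n ℤ.* n) (trans (ℤ.pos-+ 1 (i ℕ.* 2)) (cong (ℤ._+_ (+ 1)) (ℤ.pos-* i 2))))
        (identity (+ i))
  where
  identity : ∀ i → (+ 1 ℤ.+ i ℤ.* + 2) ℤ.* (+ 1 ℤ.+ i ℤ.* + 2) ≡ + 4 ℤ.* (i ℤ.* i ℤ.+ i) ℤ.+ + 1
  identity = solve-∀

primitive-reduction : ∀ {p q} → Coprime p q → PrimitiveReduction (+ p) (+ q)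
primitive-reduction {p} {q} p⊥q with p divMod 2 | q divMod 2
... | result i zero p≡2i | result j zero q≡2j =
  ⊥-elim (2≢1 (p⊥q (ℕ∣.divides i p≡2i , ℕ∣.divides j q≡2j)))
  where
  2≢1 : 2 ≢ 1
  2≢1 ()
... | result i zero p≡2i | result j (suc zero) _ =
  reduction-when-one-is-even p⊥q (inj₁ (even⇒2∣ i p≡2i))
... | result i (suc zero) _ | result j zero q≡2j =
  reduction-when-one-is-even p⊥q (inj₂ (even⇒2∣ j q≡2j))
... | result i (suc zero) p≡1+2i | result j (suc zero) q≡1+2j =
  OddReduction.reduction (+ p) (+ q) (+ i ℤ.* + i ℤ.+ + i) (+ j ℤ.* + j ℤ.+ + j)
    (odd⇒square≡4a+1 i p≡1+2i) (odd⇒square≡4a+1 j q≡1+2j) (coprime⇒no-common-prime p⊥q)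

-- Triangles with rational sides

open import Data.Rational using (_+_; _-_; _*_; _<_; _≤_)

*-pos : ∀ {x y} → 0ℚ < x → 0ℚ < y → 0ℚ < x * y
*-pos {x} {y} x>0 y>0 =
  ℚ.positive⁻¹ (x * y) {{ℚ.pos*pos⇒pos x {{ℚ.positive x>0}} y {{ℚ.positive y>0}}}}

+-pos : ∀ {x y} → 0ℚ < x → 0ℚ < y → 0ℚ < x + y
+-pos {x} {y} x>0 y>0 =
  ℚ.positive⁻¹ (x + y) {{ℚ.pos+pos⇒pos x {{ℚ.positive x>0}} y {{ℚ.positive y>0}}}}

+-nonNeg-pos : ∀ {x y} → 0ℚ ≤ x → 0ℚ < y → 0ℚ < x + y
+-nonNeg-pos {x} {y} x≥0 y>0 =
  ℚ.positive⁻¹ (x + y) {{ℚ.nonNeg+pos⇒pos x {{ℚ.nonNegative x≥0}} y {{ℚ.positive y>0}}}}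

square-nonNeg : ∀ x → 0ℚ ≤ x * x
square-nonNeg x with ℚ.<-cmp x 0ℚ
... | tri< x<0 _ _  = ℚ.<⇒≤ (ℚ.positive⁻¹ (x * x) {{ℚ.neg*neg⇒pos x {{ℚ.negative x<0}} x {{ℚ.negative x<0}}}})
... | tri≈ _ refl _ = ℚ.≤-refl
... | tri> _ _ x>0  = ℚ.<⇒≤ (*-pos x>0 x>0)

square-pos : ∀ {x} → x ≢ 0ℚ → 0ℚ < x * x
square-pos {x} x≢0 with ℚ.<-cmp x 0ℚ
... | tri< x<0 _ _ = ℚ.positive⁻¹ (x * x) {{ℚ.neg*neg⇒pos x {{ℚ.negative x<0}} x {{ℚ.negative x<0}}}}
... | tri≈ _ x≡0 _ = ⊥-elim (x≢0 x≡0)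
... | tri> _ _ x>0 = *-pos x>0 x>0

pos⇒≢0 : ∀ {x} → 0ℚ < x → x ≢ 0ℚ
pos⇒≢0 x>0 x≡0 = ℚ.<-irrefl (sym x≡0) x>0

*-≢0 : ∀ {x y} → x ≢ 0ℚ → y ≢ 0ℚ → x * y ≢ 0ℚ
*-≢0 {x} {y} x≢0 y≢0 xy≡0 =
  pos⇒≢0 (subst (0ℚ <_) rearrange (*-pos (square-pos x≢0) (square-pos y≢0))) (cong (λ v → v * v) xy≡0)
  where
  rearrange : x * x * (y * y) ≡ x * y * (x * y)
  rearrange = ℚS.prove (x ∷ y ∷ []) (ℤ→ℚ (X :* X :* (Y :* Y))) (ℤ→ℚ (X :* Y :* (X :* Y))) refl

0<-⇒< : ∀ {x y} → 0ℚ < y - x → x < y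
0<-⇒< {x} {y} 0<y-x = subst₂ _<_ (ℚ.+-identityˡ x) y-x+x≡y (ℚ.+-monoˡ-< x 0<y-x)
  where
  y-x+x≡y : y - x + x ≡ y
  y-x+x≡y = ℚS.prove (x ∷ y ∷ []) (ℤ→ℚ (Y :- X :+ X)) (ℤ→ℚ Y) refl

<⇒0<- : ∀ {x y} → x < y → 0ℚ < y - x
<⇒0<- {x} {y} x<y = subst (_< y - x) (ℚ.+-inverseʳ x) (ℚ.+-monoˡ-< (ℚ.- x) x<y)

abs-pos : ∀ {x} → x ≢ 0ℚ → 0ℚ < ℚ.∣ x ∣
abs-pos {x} x≢0 with ℚ.<-cmp 0ℚ ℚ.∣ x ∣
... | tri< 0<∣x∣ _ _ = 0<∣x∣
... | tri≈ _ 0≡∣x∣ _ = ⊥-elim (x≢0 (ℚ.∣p∣≡0⇒p≡0 x (sym 0≡∣x∣)))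
... | tri> _ _ ∣x∣<0 = ⊥-elim (ℚ.<-irrefl refl (ℚ.<-≤-trans ∣x∣<0 (ℚ.0≤∣p∣ x)))

abs-square : ∀ x → ℚ.∣ x ∣ * ℚ.∣ x ∣ ≡ x * x
abs-square x with ℚ.∣p∣≡p∨∣p∣≡-p x
... | inj₁ ∣x∣≡x  = cong (λ v → v * v) ∣x∣≡x
... | inj₂ ∣x∣≡-x = trans (cong (λ v → v * v) ∣x∣≡-x)
                          (ℚS.solve 1 (λ x → ℚS.:- x ℚS.:* ℚS.:- x ℚS.:= x ℚS.:* x) refl x)

^-pos : ∀ {x} → 0ℚ < x → ∀ n → 0ℚ < x ^ n
^-pos x>0 zero    = ℚ.positive⁻¹ 1ℚ
^-pos x>0 (suc n) = *-pos x>0 (^-pos x>0 n)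

heronProduct : ℚ → ℚ → ℚ → ℚ
heronProduct a b c = (a + b + c) * (b + c - a) * (a + c - b) * (a + b - c)

IsTriangle : ℚ → ℚ → ℚ → Set
IsTriangle a b c = (0ℚ < a) × (0ℚ < b) × (0ℚ < c) × (c < a + b) × (b < a + c) × (a < b + c)

IsHeronArea : ℚ → ℚ → ℚ → ℚ → Set
IsHeronArea a b c A = (0ℚ < A) × (16ℚ * A * A ≡ heronProduct a b c)

triangle-from-differences : ∀ {a b c} → 0ℚ < b + c - a → 0ℚ < a + c - b → 0ℚ < a + b - c →
                            IsTriangle a b c
triangle-from-differences {a} {b} {c} bc-a>0 ac-b>0 ab-c>0 =
  half-sum-pos a≡ ab-c>0 ac-b>0 , half-sum-pos b≡ ab-c>0 bc-a>0 , half-sum-pos c≡ ac-b>0 bc-a>0 ,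
  0<-⇒< ab-c>0 , 0<-⇒< ac-b>0 , 0<-⇒< bc-a>0
  where
  half-sum-pos : ∀ {s x y} → ℚ.½ * (x + y) ≡ s → 0ℚ < x → 0ℚ < y → 0ℚ < s
  half-sum-pos eq x>0 y>0 = subst (0ℚ <_) eq (*-pos (ℚ.positive⁻¹ ℚ.½) (+-pos x>0 y>0))
  a≡ : ℚ.½ * ((a + b - c) + (a + c - b)) ≡ a
  a≡ = ℚS.solve 3 (λ a b c → ℚS.con ℚ.½ ℚS.:* ((a ℚS.:+ b ℚS.:- c) ℚS.:+ (a ℚS.:+ c ℚS.:- b))
                               ℚS.:= a) refl a b c
  b≡ : ℚ.½ * ((a + b - c) + (b + c - a)) ≡ b
  b≡ = ℚS.solve 3 (λ a b c → ℚS.con ℚ.½ ℚS.:* ((a ℚS.:+ b ℚS.:- c) ℚS.:+ (b ℚS.:+ c ℚS.:- a))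
                               ℚS.:= b) refl a b c
  c≡ : ℚ.½ * ((a + c - b) + (b + c - a)) ≡ c
  c≡ = ℚS.solve 3 (λ a b c → ℚS.con ℚ.½ ℚS.:* ((a ℚS.:+ c ℚS.:- b) ℚS.:+ (b ℚS.:+ c ℚS.:- a))
                               ℚS.:= c) refl a b c

heronProduct-pos : ∀ {a b c} → IsTriangle a b c → 0ℚ < heronProduct a b c
heronProduct-pos (a>0 , b>0 , c>0 , c<a+b , b<a+c , a<b+c) =
  *-pos (*-pos (*-pos (+-pos (+-pos a>0 b>0) c>0) (<⇒0<- a<b+c)) (<⇒0<- b<a+c)) (<⇒0<- c<a+b)

heron-area : ∀ {a b c Z} → IsTriangle a b c → 16ℚ * Z * Z ≡ heronProduct a b c →
             IsHeronArea a b c ℚ.∣ Z ∣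
heron-area {a} {b} {c} {Z} triangle heron = abs-pos Z≢0 , (begin
  16ℚ * ℚ.∣ Z ∣ * ℚ.∣ Z ∣     ≡⟨ ℚ.*-assoc 16ℚ ℚ.∣ Z ∣ ℚ.∣ Z ∣ ⟩
  16ℚ * (ℚ.∣ Z ∣ * ℚ.∣ Z ∣)   ≡⟨ cong (16ℚ *_) (abs-square Z) ⟩
  16ℚ * (Z * Z)               ≡⟨ ℚ.*-assoc 16ℚ Z Z ⟨
  16ℚ * Z * Z                 ≡⟨ heron ⟩
  heronProduct a b c          ∎)
  where
  open ≡-Reasoning
  Z≢0 : Z ≢ 0ℚ
  Z≢0 refl = pos⇒≢0 (heronProduct-pos triangle) (sym heron)

scale-triangle : ∀ {μ a b c a′ b′ c′} → 0ℚ < μ → μ * a ≡ a′ → μ * b ≡ b′ → μ * c ≡ c′ →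
                 IsTriangle a b c → IsTriangle a′ b′ c′
scale-triangle {μ} μ>0 refl refl refl (a>0 , b>0 , c>0 , c<a+b , b<a+c , a<b+c) =
  *-pos μ>0 a>0 , *-pos μ>0 b>0 , *-pos μ>0 c>0 , scale-< c<a+b , scale-< b<a+c , scale-< a<b+c
  where
  scale-< : ∀ {x y z} → x < y + z → μ * x < μ * y + μ * z
  scale-< {x} {y} {z} x<y+z =
    subst (μ * x <_) (ℚ.*-distribˡ-+ μ y z) (ℚ.*-monoʳ-<-pos μ {{ℚ.positive μ>0}} x<y+z)

scale-area : ∀ {μ a b c A a′ b′ c′ A′} → 0ℚ < μ → μ * a ≡ a′ → μ * b ≡ b′ → μ * c ≡ c′ →
             μ * μ * A ≡ A′ → IsHeronArea a b c A → IsHeronArea a′ b′ c′ A′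
scale-area {μ} {a} {b} {c} {A} μ>0 refl refl refl refl (A>0 , heron) = *-pos (*-pos μ>0 μ>0) A>0 , (begin
  16ℚ * (μ * μ * A) * (μ * μ * A)       ≡⟨ ℚS.solve 2 (λ μ A →
                                             ℚS.con 16ℚ ℚS.:* (μ ℚS.:* μ ℚS.:* A) ℚS.:* (μ ℚS.:* μ ℚS.:* A)
                                             ℚS.:= μ ℚS.:* μ ℚS.:* (μ ℚS.:* μ) ℚS.:* (ℚS.con 16ℚ ℚS.:* A ℚS.:* A))
                                           refl μ A ⟩
  μ * μ * (μ * μ) * (16ℚ * A * A)       ≡⟨ cong (μ * μ * (μ * μ) *_) heron ⟩
  μ * μ * (μ * μ) * heronProduct a b c  ≡⟨ ℚS.solve 4 (λ μ a b c →
                                             μ ℚS.:* μ ℚS.:* (μ ℚS.:* μ) ℚS.:* heron⁺ a b c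
                                             ℚS.:= heron⁺ (μ ℚS.:* a) (μ ℚS.:* b) (μ ℚS.:* c))
                                           refl μ a b c ⟩
  heronProduct (μ * a) (μ * b) (μ * c)  ∎)
  where
  open ≡-Reasoning
  heron⁺ : ∀ {n} → ℚS.Polynomial n → ℚS.Polynomial n → ℚS.Polynomial n → ℚS.Polynomial n
  heron⁺ a b c = (a ℚS.:+ b ℚS.:+ c) ℚS.:* (b ℚS.:+ c ℚS.:- a) ℚS.:* (a ℚS.:+ c ℚS.:- b)
                 ℚS.:* (a ℚS.:+ b ℚS.:- c)

rational-triangle : ∀ {a b c A} → IsTriangle a b c → IsHeronArea a b c A →
                    RationalTriangleWithRationalArea a b c
rational-triangle {A = A} (a>0 , b>0 , c>0 , c<a+b , b<a+c , a<b+c) area =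
  a>0 , b>0 , c>0 , c<a+b , b<a+c , a<b+c , A , area

ℕ→ℚ-+ : ∀ m n → ℕ→ℚ (m ℕ.+ n) ≡ ℕ→ℚ m + ℕ→ℚ n
ℕ→ℚ-+ m n = trans (ℕ→ℚ≡ι (m ℕ.+ n)) (trans (cong ι (ℤ.pos-+ m n))
  (trans (ι-+ (+ m) (+ n)) (sym (cong₂ _+_ (ℕ→ℚ≡ι m) (ℕ→ℚ≡ι n)))))

ℕ→ℚ-* : ∀ m n → ℕ→ℚ (m ℕ.* n) ≡ ℕ→ℚ m * ℕ→ℚ n
ℕ→ℚ-* m n = trans (ℕ→ℚ≡ι (m ℕ.* n)) (trans (cong ι (ℤ.pos-* m n))
  (trans (ι-* (+ m) (+ n)) (sym (cong₂ _*_ (ℕ→ℚ≡ι m) (ℕ→ℚ≡ι n)))))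

ℕ→ℚ-∸ : ∀ {m n} → n ℕ.≤ m → ℕ→ℚ (m ℕ.∸ n) ≡ ℕ→ℚ m - ℕ→ℚ n
ℕ→ℚ-∸ {m} {n} n≤m = trans (ℕ→ℚ≡ι (m ℕ.∸ n))
  (trans (cong ι (trans (sym (ℤ.⊖-≥ n≤m)) (sym (ℤ.m-n≡m⊖n m n))))
  (trans (ι-- (+ m) (+ n)) (sym (cong₂ _-_ (ℕ→ℚ≡ι m) (ℕ→ℚ≡ι n)))))

ℕ→ℚ-cancel-< : ∀ {m n} → ℕ→ℚ m < ℕ→ℚ n → m ℕ.< n
ℕ→ℚ-cancel-< {m} {n} m<n with subst₂ _<_ (ℕ→ℚ≡ι m) (ℕ→ℚ≡ι n) m<n
... | ℚ.*<* m*1<n*1 = ℤ.drop‿+<+ (subst₂ ℤ._<_ (ℤ.*-identityʳ (+ m)) (ℤ.*-identityʳ (+ n)) m*1<n*1)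

ℕ→ℚ-injective : ∀ {m n} → ℕ→ℚ m ≡ ℕ→ℚ n → m ≡ n
ℕ→ℚ-injective {m} {n} m≡n =
  ℤ.+-injective (ι-injective (trans (sym (ℕ→ℚ≡ι m)) (trans m≡n (ℕ→ℚ≡ι n))))

heron-triangle-ℕ : ∀ {x y z s} → IsTriangle (ℕ→ℚ x) (ℕ→ℚ y) (ℕ→ℚ z) →
                   IsHeronArea (ℕ→ℚ x) (ℕ→ℚ y) (ℕ→ℚ z) (ℕ→ℚ s) → HeronTriangle x y z
heron-triangle-ℕ {x} {y} {z} {s} (x>0 , y>0 , z>0 , z<x+y , y<x+z , x<y+z) (s>0 , heron) =
  ℕ→ℚ-cancel-< {0} x>0 , ℕ→ℚ-cancel-< {0} y>0 , ℕ→ℚ-cancel-< {0} z>0 ,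
  z<x+yₙ , y<x+zₙ , x<y+zₙ , s , ℕ→ℚ-cancel-< {0} s>0 , ℕ→ℚ-injective (begin
    ℕ→ℚ (16 ℕ.* s ℕ.* s)                   ≡⟨ trans (ℕ→ℚ-* (16 ℕ.* s) s) (cong (_* ℕ→ℚ s) (ℕ→ℚ-* 16 s)) ⟩
    16ℚ * ℕ→ℚ s * ℕ→ℚ s                     ≡⟨ heron ⟩
    heronProduct (ℕ→ℚ x) (ℕ→ℚ y) (ℕ→ℚ z)    ≡⟨ factors-hom ⟨
    ℕ→ℚ (x ℕ.+ y ℕ.+ z) * ℕ→ℚ (y ℕ.+ z ℕ.∸ x) * ℕ→ℚ (x ℕ.+ z ℕ.∸ y) * ℕ→ℚ (x ℕ.+ y ℕ.∸ z)
                       ≡⟨ product-hom (x ℕ.+ y ℕ.+ z) (y ℕ.+ z ℕ.∸ x) (x ℕ.+ z ℕ.∸ y) (x ℕ.+ y ℕ.∸ z) ⟨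
    ℕ→ℚ ((x ℕ.+ y ℕ.+ z) ℕ.* (y ℕ.+ z ℕ.∸ x) ℕ.* (x ℕ.+ z ℕ.∸ y) ℕ.* (x ℕ.+ y ℕ.∸ z)) ∎)
  where
  open ≡-Reasoning
  cancel-<-sum : ∀ {m n o} → ℕ→ℚ m < ℕ→ℚ n + ℕ→ℚ o → m ℕ.< n ℕ.+ o
  cancel-<-sum {m} {n} {o} m<n+o = ℕ→ℚ-cancel-< (subst (ℕ→ℚ m <_) (sym (ℕ→ℚ-+ n o)) m<n+o)
  z<x+yₙ : z ℕ.< x ℕ.+ y
  z<x+yₙ = cancel-<-sum {z} {x} {y} z<x+y
  y<x+zₙ : y ℕ.< x ℕ.+ z
  y<x+zₙ = cancel-<-sum {y} {x} {z} y<x+z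
  x<y+zₙ : x ℕ.< y ℕ.+ z
  x<y+zₙ = cancel-<-sum {x} {y} {z} x<y+z
  difference-hom : ∀ m n {o} → o ℕ.< m ℕ.+ n → ℕ→ℚ (m ℕ.+ n ℕ.∸ o) ≡ ℕ→ℚ m + ℕ→ℚ n - ℕ→ℚ o
  difference-hom m n {o} o<m+n = trans (ℕ→ℚ-∸ (ℕ.<⇒≤ o<m+n)) (cong (_- ℕ→ℚ o) (ℕ→ℚ-+ m n))
  factors-hom : ℕ→ℚ (x ℕ.+ y ℕ.+ z) * ℕ→ℚ (y ℕ.+ z ℕ.∸ x) * ℕ→ℚ (x ℕ.+ z ℕ.∸ y) * ℕ→ℚ (x ℕ.+ y ℕ.∸ z)
                ≡ heronProduct (ℕ→ℚ x) (ℕ→ℚ y) (ℕ→ℚ z)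
  factors-hom = cong₂ _*_ (cong₂ _*_ (cong₂ _*_ (trans (ℕ→ℚ-+ (x ℕ.+ y) z) (cong (_+ ℕ→ℚ z) (ℕ→ℚ-+ x y)))
                                                (difference-hom y z x<y+zₙ))
                                     (difference-hom x z y<x+zₙ))
                          (difference-hom x y z<x+yₙ)
  product-hom : ∀ m n o p → ℕ→ℚ (m ℕ.* n ℕ.* o ℕ.* p) ≡ ℕ→ℚ m * ℕ→ℚ n * ℕ→ℚ o * ℕ→ℚ p
  product-hom m n o p = trans (ℕ→ℚ-* (m ℕ.* n ℕ.* o) p)
    (cong (_* ℕ→ℚ p) (trans (ℕ→ℚ-* (m ℕ.* n) o) (cong (_* ℕ→ℚ o) (ℕ→ℚ-* m n))))

-- The family

a+b-c≡ : ∀ k → aₖ k + bₖ k - cₖ k ≡ ℕ→ℚ 8 * k * 𝕌 ⟨ k ⟩ * ((k + 1ℚ) * 𝔾₃ ⟨ k ⟩) * ((k + 1ℚ) * 𝔾₃ ⟨ k ⟩)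
a+b-c≡ k = ℚS.prove (k ∷ []) (dehomogenise (𝕋 :* 𝕋 :+ 𝔹 :- 𝕊 :* 𝕊))
  (dehomogenise (con (+ 8) :* Y :* X :* 𝕌 :* ((X :+ Y) :* 𝔾₃) :* ((X :+ Y) :* 𝔾₃))) refl

a+c-b≡ : ∀ k → aₖ k + cₖ k - bₖ k ≡ ℕ→ℚ 2 * 𝕄 ⟨ k ⟩ * 𝔾₃ ⟨ k ⟩ * 𝔾₃ ⟨ k ⟩
a+c-b≡ k = ℚS.prove (k ∷ []) (dehomogenise (𝕋 :* 𝕋 :+ 𝕊 :* 𝕊 :- 𝔹))
  (dehomogenise (con (+ 2) :* 𝕄 :* 𝔾₃ :* 𝔾₃)) refl

b+c-a≡ : ∀ k → bₖ k + cₖ k - aₖ k ≡ ℕ→ℚ 8 * k * 𝕌 ⟨ k ⟩ * ((k - 1ℚ) * 𝔾₄ ⟨ k ⟩) * ((k - 1ℚ) * 𝔾₄ ⟨ k ⟩)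
b+c-a≡ k = ℚS.prove (k ∷ []) (dehomogenise (𝔹 :+ 𝕊 :* 𝕊 :- 𝕋 :* 𝕋))
  (dehomogenise (con (+ 8) :* Y :* X :* 𝕌 :* ((X :- Y) :* 𝔾₄) :* ((X :- Y) :* 𝔾₄))) refl

𝕋≡𝔾₃𝔾₄ : ∀ k → 𝕋 ⟨ k ⟩ ≡ 𝔾₃ ⟨ k ⟩ * 𝔾₄ ⟨ k ⟩
𝕋≡𝔾₃𝔾₄ k = ℚS.prove (k ∷ []) (dehomogenise 𝕋) (dehomogenise (𝔾₃ :* 𝔾₄)) refl

heron-identity : ∀ k → 16ℚ * 𝔸 ⟨ k ⟩ * 𝔸 ⟨ k ⟩ ≡ heronProduct (aₖ k) (bₖ k) (cₖ k)
heron-identity k = ℚS.prove (k ∷ []) (dehomogenise (con (+ 16) :* 𝔸 :* 𝔸))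
  (dehomogenise ((𝕒 :+ 𝔹 :+ 𝕔) :* (𝔹 :+ 𝕔 :- 𝕒) :* (𝕒 :+ 𝕔 :- 𝔹) :* (𝕒 :+ 𝔹 :- 𝕔))) refl
  where
  𝕒 𝕔 : Polynomial 2
  𝕒 = 𝕋 :* 𝕋
  𝕔 = 𝕊 :* 𝕊

𝕌-pos : ∀ k → 0ℚ < 𝕌 ⟨ k ⟩
𝕌-pos k = +-nonNeg-pos (square-nonNeg (X² ⟨ k ⟩)) (ℚ.positive⁻¹ 1ℚ)

𝕄-pos : ∀ {k} → k ≢ 0ℚ → 0ℚ < 𝕄 ⟨ k ⟩
𝕄-pos {k} k≢0 = +-nonNeg-pos (square-nonNeg ((𝕎 :* 𝕎) ⟨ k ⟩))
                             (*-pos (ℚ.positive⁻¹ (ℕ→ℚ 4)) (square-pos (*-≢0 k≢0 k≢0)))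

family-triangle : ∀ {k} → 0ℚ < k → k ≢ 1ℚ → 𝕋 ⟨ k ⟩ ≢ 0ℚ → IsTriangle (aₖ k) (bₖ k) (cₖ k)
family-triangle {k} k>0 k≢1 t≢0 = triangle-from-differences
  (subst (0ℚ <_) (sym (b+c-a≡ k)) (pos*square 8ku>0 (*-≢0 k-1≢0 g₄≢0)))
  (subst (0ℚ <_) (sym (a+c-b≡ k)) (pos*square (*-pos (ℚ.positive⁻¹ (ℕ→ℚ 2)) (𝕄-pos (pos⇒≢0 k>0))) g₃≢0))
  (subst (0ℚ <_) (sym (a+b-c≡ k)) (pos*square 8ku>0 (*-≢0 (pos⇒≢0 (+-pos k>0 (ℚ.positive⁻¹ 1ℚ))) g₃≢0)))
  where
  pos*square : ∀ {c x} → 0ℚ < c → x ≢ 0ℚ → 0ℚ < c * x * x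
  pos*square {c} {x} c>0 x≢0 = subst (0ℚ <_) (sym (ℚ.*-assoc c x x)) (*-pos c>0 (square-pos x≢0))
  8ku>0 : 0ℚ < ℕ→ℚ 8 * k * 𝕌 ⟨ k ⟩
  8ku>0 = *-pos (*-pos (ℚ.positive⁻¹ (ℕ→ℚ 8)) k>0) (𝕌-pos k)
  g₃≢0 : 𝔾₃ ⟨ k ⟩ ≢ 0ℚ
  g₃≢0 g₃≡0 = t≢0 (trans (𝕋≡𝔾₃𝔾₄ k) (trans (cong (_* 𝔾₄ ⟨ k ⟩) g₃≡0) (ℚ.*-zeroˡ (𝔾₄ ⟨ k ⟩))))
  g₄≢0 : 𝔾₄ ⟨ k ⟩ ≢ 0ℚ
  g₄≢0 g₄≡0 = t≢0 (trans (𝕋≡𝔾₃𝔾₄ k) (trans (cong (𝔾₃ ⟨ k ⟩ *_) g₄≡0) (ℚ.*-zeroʳ (𝔾₃ ⟨ k ⟩))))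
  k-1≢0 : k - 1ℚ ≢ 0ℚ
  k-1≢0 k-1≡0 = k≢1 (trans (ℚS.solve 1 (λ k → k ℚS.:= k ℚS.:- ℚS.con 1ℚ ℚS.:+ ℚS.con 1ℚ) refl k)
                           (cong (_+ 1ℚ) k-1≡0))

clear-denominator : ∀ n d-1 .(c : Coprime ℤ.∣ n ∣ (suc d-1)) → mkℚ n d-1 c * ι (+ suc d-1) ≡ ι n
clear-denominator n d-1 c = ℚ.toℚᵘ-injective (ℚᵘ.≃-trans
  (ℚ.toℚᵘ-homo-* (mkℚ n d-1 c) (ι (+ suc d-1))) (ℚᵘ.*≡* (identity n (+ suc d-1))))
  where
  identity : ∀ n q → n ℤ.* q ℤ.* + 1 ≡ n ℤ.* (q ℤ.* + 1)
  identity = solve-∀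

module AtFraction {p q : ℕ} (p⊥q : Coprime p q) (q>0 : 0 ℕ.< q) (k : ℚ) (kq≡p : k * ι (+ q) ≡ ι (+ p))
  where

  open PrimitiveReduction (primitive-reduction p⊥q) public

  δ μ scale : ℚ
  δ = (ℚ.1/ ι (+ d)) {{d≢0}}
  μ = ι (+ q) ^ 8 * δ
  scale = μ * μ

  bridge : ∀ n e → IsHomogeneous n e → ι (+ q) ^ n * e ⟨ k ⟩ ≡ ι (e ⟦ + p , + q ⟧)
  bridge n e homogeneous = homogeneous-at-fraction n e homogeneous {k} {+ p} {+ q} kq≡p

  δ>0 : 0ℚ < δ
  δ>0 = ℚ.positive⁻¹ δ {{ℚ.1/pos⇒pos (ι (+ d)) {{ℚ.positive (ι-pos (ℕ.>-nonZero⁻¹ d {{d≢0}}))}}}}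

  scale>0 : 0ℚ < scale
  scale>0 = *-pos μ>0 μ>0
    where
    μ>0 : 0ℚ < μ
    μ>0 = *-pos (^-pos (ι-pos q>0) 8) δ>0

  δ-cancel : ∀ z → δ * ι (+ d ℤ.* z) ≡ ι z
  δ-cancel z = begin
    δ * ι (+ d ℤ.* z)    ≡⟨ cong (δ *_) (ι-* (+ d) z) ⟩
    δ * (ι (+ d) * ι z)  ≡⟨ ℚ.*-assoc δ (ι (+ d)) (ι z) ⟨
    δ * ι (+ d) * ι z    ≡⟨ cong (_* ι z) (ℚ.*-inverseˡ (ι (+ d)) {{d≢0}}) ⟩
    1ℚ * ι z             ≡⟨ ℚ.*-identityˡ (ι z) ⟩
    ι z                  ∎
    where open ≡-Reasoning

  δ²-cancel : ∀ z → δ * (δ * ι (+ d ℤ.* (+ d ℤ.* z))) ≡ ι z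
  δ²-cancel z = trans (cong (δ *_) (δ-cancel (+ d ℤ.* z))) (δ-cancel z)

  𝕋⟨k⟩≢0 : 𝕋 ⟨ k ⟩ ≢ 0ℚ
  𝕋⟨k⟩≢0 t≡0 = 𝕋≢0 p⊥q (ι-injective (begin
    ι (𝕋 ⟦ + p , + q ⟧)    ≡⟨ bridge 8 𝕋 𝕋-homogeneous ⟨
    ι (+ q) ^ 8 * 𝕋 ⟨ k ⟩  ≡⟨ cong (ι (+ q) ^ 8 *_) t≡0 ⟩
    ι (+ q) ^ 8 * 0ℚ       ≡⟨ ℚ.*-zeroʳ (ι (+ q) ^ 8) ⟩
    0ℚ                     ∎))
    where open ≡-Reasoning

  private
    scaled-form : ∀ e {w} → IsHomogeneous 8 e → e ⟦ + p , + q ⟧ ≡ + d ℤ.* w → μ * e ⟨ k ⟩ ≡ ι w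
    scaled-form e {w} homogeneous e≡dw = begin
      ι (+ q) ^ 8 * δ * e ⟨ k ⟩    ≡⟨ ℚS.solve 3 (λ Q δ t → Q ℚS.:^ 8 ℚS.:* δ ℚS.:* t
                                         ℚS.:= δ ℚS.:* (Q ℚS.:^ 8 ℚS.:* t)) refl (ι (+ q)) δ (e ⟨ k ⟩) ⟩
      δ * (ι (+ q) ^ 8 * e ⟨ k ⟩)  ≡⟨ cong (δ *_) (bridge 8 e homogeneous) ⟩
      δ * ι (e ⟦ + p , + q ⟧)      ≡⟨ cong (λ v → δ * ι v) e≡dw ⟩
      δ * ι (+ d ℤ.* w)            ≡⟨ δ-cancel w ⟩
      ι w                          ∎
      where open ≡-Reasoning

    scaled-square-form : ∀ e {w} → IsHomogeneous 8 e → e ⟦ + p , + q ⟧ ≡ + d ℤ.* w →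
                         scale * (e ⟨ k ⟩ * e ⟨ k ⟩) ≡ ℕ→ℚ (ℤ.∣ w ∣ ℕ.* ℤ.∣ w ∣)
    scaled-square-form e {w} homogeneous e≡dw = begin
      μ * μ * (e ⟨ k ⟩ * e ⟨ k ⟩)  ≡⟨ ℚS.prove (μ ∷ e ⟨ k ⟩ ∷ []) (ℤ→ℚ (X :* X :* (Y :* Y)))
                                                                  (ℤ→ℚ (X :* Y :* (X :* Y))) refl ⟩
      μ * e ⟨ k ⟩ * (μ * e ⟨ k ⟩)  ≡⟨ cong (λ v → v * v) (scaled-form e homogeneous e≡dw) ⟩
      ι w * ι w                    ≡⟨ ι*ι≡ℕ→ℚ∣∣*∣∣ w ⟩
      ℕ→ℚ (ℤ.∣ w ∣ ℕ.* ℤ.∣ w ∣)    ∎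
      where open ≡-Reasoning

  scaled-a : scale * aₖ k ≡ ℕ→ℚ (ℤ.∣ x ∣ ℕ.* ℤ.∣ x ∣)
  scaled-a = scaled-square-form 𝕋 𝕋-homogeneous 𝕋≡

  scaled-c : scale * cₖ k ≡ ℕ→ℚ (ℤ.∣ z ∣ ℕ.* ℤ.∣ z ∣)
  scaled-c = scaled-square-form 𝕊 𝕊-homogeneous 𝕊≡

  scaled-b : 0ℚ < bₖ k → scale * bₖ k ≡ ℕ→ℚ ℤ.∣ y ∣
  scaled-b b>0 = trans scale*b≡ιy (0<ι⇒ι≡ℕ→ℚ∣∣ (subst (0ℚ <_) scale*b≡ιy (*-pos scale>0 b>0)))
    where
    open ≡-Reasoning
    scale*b≡ιy : scale * bₖ k ≡ ι y
    scale*b≡ιy = begin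
      μ * μ * bₖ k                        ≡⟨ ℚS.solve 3 (λ Q δ b →
                                               Q ℚS.:^ 8 ℚS.:* δ ℚS.:* (Q ℚS.:^ 8 ℚS.:* δ) ℚS.:* b
                                               ℚS.:= δ ℚS.:* (δ ℚS.:* (Q ℚS.:^ 16 ℚS.:* b)))
                                             refl (ι (+ q)) δ (bₖ k) ⟩
      δ * (δ * (ι (+ q) ^ 16 * 𝔹 ⟨ k ⟩))  ≡⟨ cong (λ v → δ * (δ * v)) (bridge 16 𝔹 𝔹-homogeneous) ⟩
      δ * (δ * ι (𝔹 ⟦ + p , + q ⟧))       ≡⟨ cong (λ v → δ * (δ * ι v)) 𝔹≡ ⟩
      δ * (δ * ι (+ d ℤ.* (+ d ℤ.* y)))   ≡⟨ δ²-cancel y ⟩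
      ι y                                 ∎

  scaled-area : scale * scale * ℚ.∣ 𝔸 ⟨ k ⟩ ∣ ≡ ℕ→ℚ ℤ.∣ s ∣
  scaled-area = begin
    scale * scale * ℚ.∣ 𝔸 ⟨ k ⟩ ∣          ≡⟨ cong (_* ℚ.∣ 𝔸 ⟨ k ⟩ ∣) (ℚ.0≤p⇒∣p∣≡p (ℚ.<⇒≤ (*-pos scale>0 scale>0))) ⟨
    ℚ.∣ scale * scale ∣ * ℚ.∣ 𝔸 ⟨ k ⟩ ∣    ≡⟨ ℚ.∣p*q∣≡∣p∣*∣q∣ (scale * scale) (𝔸 ⟨ k ⟩) ⟨
    ℚ.∣ scale * scale * 𝔸 ⟨ k ⟩ ∣          ≡⟨ cong ℚ.∣_∣ scale²A≡ιs ⟩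
    ℚ.∣ ι s ∣                              ≡⟨ ∣ι∣≡ℕ→ℚ∣∣ s ⟩
    ℕ→ℚ ℤ.∣ s ∣                            ∎
    where
    open ≡-Reasoning
    scale²A≡ιs : scale * scale * 𝔸 ⟨ k ⟩ ≡ ι s
    scale²A≡ιs = begin
      μ * μ * (μ * μ) * 𝔸 ⟨ k ⟩
        ≡⟨ ℚS.solve 3 (λ Q δ A →
             Q ℚS.:^ 8 ℚS.:* δ ℚS.:* (Q ℚS.:^ 8 ℚS.:* δ) ℚS.:* (Q ℚS.:^ 8 ℚS.:* δ ℚS.:* (Q ℚS.:^ 8 ℚS.:* δ)) ℚS.:* A
             ℚS.:= δ ℚS.:* (δ ℚS.:* (δ ℚS.:* (δ ℚS.:* (Q ℚS.:^ 32 ℚS.:* A))))) refl (ι (+ q)) δ (𝔸 ⟨ k ⟩) ⟩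
      δ * (δ * (δ * (δ * (ι (+ q) ^ 32 * 𝔸 ⟨ k ⟩))))
        ≡⟨ cong (λ v → δ * (δ * (δ * (δ * v)))) (bridge 32 𝔸 𝔸-homogeneous) ⟩
      δ * (δ * (δ * (δ * ι (𝔸 ⟦ + p , + q ⟧))))
        ≡⟨ cong (λ v → δ * (δ * (δ * (δ * ι v)))) 𝔸≡ ⟩
      δ * (δ * (δ * (δ * ι (+ d ℤ.* (+ d ℤ.* (+ d ℤ.* (+ d ℤ.* s)))))))
        ≡⟨ cong (λ v → δ * (δ * v)) (δ²-cancel _) ⟩
      δ * (δ * ι (+ d ℤ.* (+ d ℤ.* s)))
        ≡⟨ δ²-cancel s ⟩
      ι s ∎

theorem1p4 : (k : ℚ) → 0ℚ < k → ¬ (k ≡ 1ℚ) →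
    RationalTriangleWithRationalArea (aₖ k) (bₖ k) (cₖ k) ×
    Σ ℚ (λ λ' → (0ℚ < λ') × Σ ℕ (λ x → Σ ℕ (λ y → Σ ℕ (λ z →
      (λ' * aₖ k ≡ ℕ→ℚ x) × (λ' * bₖ k ≡ ℕ→ℚ y) × (λ' * cₖ k ≡ ℕ→ℚ z) ×
      PrimitiveHeronTriangle x y z × IsSquare x × IsSquare z))))
theorem1p4 (mkℚ -[1+ _ ] _ _) (ℚ.*<* ()) _
theorem1p4 k@(mkℚ (+ p) q-1 p⊥q) k>0 k≢1 =
  rational-triangle triangle area ,
  scale , scale>0 , ℤ.∣ x ∣ ℕ.* ℤ.∣ x ∣ , ℤ.∣ y ∣ , ℤ.∣ z ∣ ℕ.* ℤ.∣ z ∣ ,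
  scaled-a , scaled-b b>0 , scaled-c ,
  ( heron-triangle-ℕ {s = ℤ.∣ s ∣} (scale-triangle scale>0 scaled-a (scaled-b b>0) scaled-c triangle)
                                   (scale-area scale>0 scaled-a (scaled-b b>0) scaled-c scaled-area area)
  , coprime⇒gcd[m²,y,n²]≡1 ℤ.∣ y ∣ x⊥z ) ,
  (ℤ.∣ x ∣ , refl) , (ℤ.∣ z ∣ , refl)
  where
  open AtFraction (Coprimality.recompute p⊥q) (ℕ.s≤s ℕ.z≤n) k (clear-denominator (+ p) q-1 p⊥q)
  triangle : IsTriangle (aₖ k) (bₖ k) (cₖ k)
  triangle = family-triangle k>0 k≢1 𝕋⟨k⟩≢0
  area : IsHeronArea (aₖ k) (bₖ k) (cₖ k) ℚ.∣ 𝔸 ⟨ k ⟩ ∣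
  area = heron-area triangle (heron-identity k)
  b>0 : 0ℚ < bₖ k
  b>0 = proj₁ (proj₂ triangle)
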